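{- Let $\mathcal{P}$ denote the set of prime numbers, and for $N\in\mathbb{N}=\{1,2,3,\dots\}$ let $$D(\mathcal{P},N)=\max\{|A| : A\subseteq\{1,2,\dots,N\},\ (A-A)\cap\mathcal{P}\subseteq\{0\}\}.$$ Then for all $N\in\mathbb{N}$, $$D(\mathcal{P},N)=\lceil N/4\rceil+1_E(N),\qquad E=\{2,3,4,11,12\},$$ where $1_E$ is the indicator function of $E$.
   Context: For a set $A$ of integers, $A-A=\{a-b: a,b\in A\}$. Thus $D(\mathcal{P},N)$ is the maximum size of a subset of $\{1,\dots,N\}$ no two distinct elements of which differ by a prime. -}

module Defs where

open import Data.Nat using (ℕ; zero; suc; _+_; _∸_; _≤_; _/_)
open import Data.Nat.Primality using (Prime)
open import Data.List using (List; length)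
open import Data.List.Membership.Propositional using (_∈_)
open import Data.List.Relation.Unary.All using (All)
open import Data.List.Relation.Unary.Unique.Propositional using (Unique)
open import Data.Product using (_×_; Σ)
open import Relation.Nullary using (¬_)
open import Relation.Binary.PropositionalEquality using (_≡_)

⌈_/4⌉ : ℕ → ℕ
⌈ n /4⌉ = (n + 3) / 4

1E : ℕ → ℕ
1E 2  = 1
1E 3  = 1
1E 4  = 1
1E 11 = 1
1E 12 = 1
1E _  = 0

SubsetOf1toN : ℕ → List ℕ → Set
SubsetOf1toN N A = Unique A × All (λ a → 1 ≤ a × a ≤ N) A

-- (A - A) ∩ P ⊆ {0}: no difference a - b (a,b ∈ A) is prime.
-- Truncated subtraction: if a < b then a ∸ b = 0, not prime; the
-- difference b - a is covered by the pair (b, a).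
PrimeDifferenceFree : List ℕ → Set
PrimeDifferenceFree A = ∀ {a b} → a ∈ A → b ∈ A → ¬ Prime (a ∸ b)

Admissible : ℕ → List ℕ → Set
Admissible N A = SubsetOf1toN N A × PrimeDifferenceFree A

IsMaxAdmissibleSize : ℕ → ℕ → Set
IsMaxAdmissibleSize N m =
  Σ (List ℕ) (λ A → Admissible N A × length A ≡ m)
  × (∀ (A : List ℕ) → Admissible N A → length A ≤ m)

-- The lower bound comes from the integers ≡ 1 (mod 4) in {1,…,N}, whose
-- differences are multiples of 4, together with explicit sets such as
-- {1,2,10,11} for the exceptional N ∈ E.  For the upper bound, the only
-- non-prime differences below 8 are 1, 4 and 6, and no three integers in a
-- window of length 8 have all their pairwise differences among them, so any 8
-- consecutive integers contain at most 2 elements of an admissible set.  Hence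
-- D(N + 8) ≤ D(N) + 2, which gives the formula for N ≥ 21 from N ≥ 13, and
-- the cases N ≤ 20 are settled by an exhaustive clique search.
module Submission where

open import Defs
open import Data.Bool.Base using (true; false; _∧_; if_then_else_)
open import Data.Fin.Base using (Fin; toℕ; fromℕ<)
open import Data.Fin.Properties as Fin using (toℕ-fromℕ<)
open import Data.List.Base using (List; []; _∷_; length; filter; map; applyUpTo)
open import Data.List.Properties using (filter-accept; filter-reject; filter-all; length-applyUpTo)
open import Data.List.Membership.Propositional using (_∈_; _∉_)
open import Data.List.Membership.Propositional.Properties
  using (∈-filter⁻; ∈-map⁺; ∈-applyUpTo⁺; ∈-applyUpTo⁻)
open import Data.List.Relation.Binary.Subset.Propositional using (_⊆_)
open import Data.List.Relation.Binary.Subset.Propositional.Properties using (filter-⊆)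
open import Data.List.Relation.Unary.All as All using (All; all?)
open import Data.List.Relation.Unary.Any using (here; there)
open import Data.List.Relation.Unary.AllPairs using (_∷_)
open import Data.List.Relation.Unary.Unique.Propositional using (Unique)
import Data.List.Relation.Unary.Unique.Propositional.Properties as Unique
open import Data.List.Relation.Unary.Unique.DecPropositional using (unique?)
open import Data.Nat.Base
open import Data.Nat.DivMod using (m/n*n≤m; +-distrib-/-∣ˡ)
open import Data.Nat.Divisibility using (divides)
open import Data.Nat.Induction using (<-rec)
open import Data.Nat.Primality using (Prime; prime?; composite[4]; composite-∣; composite⇒¬prime; prime⇒nonZero)
open import Data.Nat.Properties
open import Data.Product using (_×_; _,_; proj₁; proj₂)
open import Data.Sum using (inj₁; inj₂)
open import Function using (_∘_; case_of_)
open import Relation.Binary.Definitions using (DecidableEquality; Decidable)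
open import Relation.Binary.PropositionalEquality
open import Relation.Nullary using (Dec; yes; no; does; ¬_; ¬?; contradiction)
open import Relation.Nullary.Decidable using (toWitness; map′; dec-true; _×-dec_)
open import Relation.Unary.Properties using (∁?)

module CliqueSearch {A : Set} (_≟_ : DecidableEquality A)
                    {R : A → A → Set} (R? : Decidable R) where

  open import Data.List.Membership.DecPropositional _≟_ using (_∈?_)

  IsClique : List A → Set
  IsClique B = ∀ {x y} → x ∈ B → y ∈ B → R x y

  isClique-⊆ : ∀ {B B′} → B′ ⊆ B → IsClique B → IsClique B′
  isClique-⊆ B′⊆B clique x∈ y∈ = clique (B′⊆B x∈) (B′⊆B y∈)

  -- The largest size of a clique drawn from the candidates C all of whose
  -- members are related to every element of S.
  maxClique : List A → List A → ℕ
  maxClique S []      = 0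
  maxClique S (x ∷ C) =
    if does (all? (R? x) S) then suc (maxClique (x ∷ S) C) ⊔ maxClique S C else maxClique S C

  maxClique-∷ : ∀ S x C → maxClique S C ≤ maxClique S (x ∷ C)
  maxClique-∷ S x C with does (all? (R? x) S)
  ... | true  = m≤n⊔m _ _
  ... | false = ≤-refl

  remove : A → List A → List A
  remove x = filter (λ y → ¬? (y ≟ x))

  ∉-remove : ∀ x B → x ∉ remove x B
  ∉-remove x B x∈ = proj₂ (∈-filter⁻ (λ y → ¬? (y ≟ x)) {xs = B} x∈) refl

  remove-⊆ : ∀ x B → remove x B ⊆ B
  remove-⊆ x = filter-⊆ (λ y → ¬? (y ≟ x))

  length-remove : ∀ {x B} → Unique B → x ∈ B → length B ≡ suc (length (remove x B))
  length-remove {x} {y ∷ B} (y∉B ∷ _) (here refl) =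
    cong (suc ∘ length) (sym (trans (filter-reject P? {xs = B} (λ x≢x → x≢x refl))
                                    (filter-all P? (All.map (λ x≢y y≡x → x≢y (sym y≡x)) y∉B))))
    where P? = λ y → ¬? (y ≟ x)
  length-remove {x} {y ∷ B} (y∉B ∷ uB) (there x∈B) =
    trans (cong suc (length-remove uB x∈B))
          (cong (suc ∘ length) (sym (filter-accept P? (All.lookup y∉B x∈B))))
    where P? = λ y → ¬? (y ≟ x)

  ⊆-∷⁻ : ∀ {x : A} {B C} → x ∉ B → B ⊆ x ∷ C → B ⊆ C
  ⊆-∷⁻ x∉B B⊆ b∈ with B⊆ b∈
  ... | here refl = contradiction b∈ x∉B
  ... | there b∈C = b∈C

  length≤maxClique : ∀ S C {B} → Unique B → IsClique B → B ⊆ C →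
                     (∀ {b s} → b ∈ B → s ∈ S → R b s) → length B ≤ maxClique S C
  length≤maxClique S [] {[]}    _ _ _    _ = z≤n
  length≤maxClique S [] {b ∷ _} _ _ B⊆[] _ with () ← B⊆[] {b} (here refl)
  length≤maxClique S (x ∷ C) {B} uB cB B⊆ BS with x ∈? B
  ... | no x∉B = ≤-trans (length≤maxClique S C uB cB (⊆-∷⁻ x∉B B⊆) BS) (maxClique-∷ S x C)
  ... | yes x∈B rewrite dec-true (all? (R? x) S) (All.tabulate (BS x∈B)) = begin
    length B                   ≡⟨ length-remove uB x∈B ⟩
    suc (length B′)            ≤⟨ s≤s (length≤maxClique (x ∷ S) C uB′ (isClique-⊆ B′⊆B cB) B′⊆C B′S) ⟩
    suc (maxClique (x ∷ S) C)  ≤⟨ m≤m⊔n _ (maxClique S C) ⟩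
    suc (maxClique (x ∷ S) C) ⊔ maxClique S C  ∎
    where
    open ≤-Reasoning
    B′ : List A
    B′ = remove x B
    B′⊆B : B′ ⊆ B
    B′⊆B = remove-⊆ x B
    uB′ : Unique B′
    uB′ = Unique.filter⁺ (λ y → ¬? (y ≟ x)) uB
    B′⊆C : B′ ⊆ C
    B′⊆C = ⊆-∷⁻ (∉-remove x B) (B⊆ ∘ B′⊆B)
    B′S : ∀ {b s} → b ∈ B′ → s ∈ x ∷ S → R b s
    B′S b∈ (here refl) = cB (B′⊆B b∈) x∈B
    B′S b∈ (there s∈S) = BS (B′⊆B b∈) s∈S

  module _ (f : A → A) (f-preserves : ∀ x y → does (R? (f x) (f y)) ≡ does (R? x y)) where

    all?-map : ∀ x S → does (all? (R? (f x)) (map f S)) ≡ does (all? (R? x) S)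
    all?-map x []      = refl
    all?-map x (s ∷ S) = cong₂ _∧_ (f-preserves x s) (all?-map x S)

    maxClique-map : ∀ S C → maxClique (map f S) (map f C) ≡ maxClique S C
    maxClique-map S []      = refl
    maxClique-map S (x ∷ C)
      rewrite all?-map x S | maxClique-map S C | maxClique-map (x ∷ S) C = refl

NonPrimeGap : ℕ → ℕ → Set
NonPrimeGap a b = ¬ Prime ∣ a - b ∣

nonPrimeGap? : Decidable NonPrimeGap
nonPrimeGap? a b = ¬? (prime? ∣ a - b ∣)

open CliqueSearch _≟_ nonPrimeGap?

primeDifferenceFree⇒isClique : ∀ {A} → PrimeDifferenceFree A → IsClique A
primeDifferenceFree⇒isClique pdf {a} {b} a∈ b∈ with ∣m-n∣≡[m∸n]∨[n∸m] a b
... | inj₁ eq rewrite eq = pdf a∈ b∈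
... | inj₂ eq rewrite eq = pdf b∈ a∈

primeDifferenceFree-⊆ : ∀ {A B} → B ⊆ A → PrimeDifferenceFree A → PrimeDifferenceFree B
primeDifferenceFree-⊆ B⊆A pdf a∈ b∈ = pdf (B⊆A a∈) (B⊆A b∈)

maxClique-+ : ∀ n S C → maxClique (map (n +_) S) (map (n +_) C) ≡ maxClique S C
maxClique-+ n = maxClique-map (n +_) λ x y → cong (does ∘ ¬? ∘ prime?) (∣m+n-m+o∣≡∣n-o∣ n x y)

positivesUpTo : ℕ → List ℕ
positivesUpTo = applyUpTo suc

∈-positivesUpTo⁺ : ∀ {n a} → 1 ≤ a → a ≤ n → a ∈ positivesUpTo n
∈-positivesUpTo⁺ {a = suc i} _ i<n = ∈-applyUpTo⁺ suc i<n

∈-shiftedPositives⁺ : ∀ {n k b} → n < b → b ≤ k + n → b ∈ map (n +_) (positivesUpTo k)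
∈-shiftedPositives⁺ {n} {k} {b} n<b b≤k+n =
  subst (_∈ map (n +_) (positivesUpTo k)) (m+[n∸m]≡n (<⇒≤ n<b))
    (∈-map⁺ (n +_) (∈-positivesUpTo⁺ (m<n⇒0<n∸m n<b)
      (subst (b ∸ n ≤_) (m+n∸n≡m k n) (∸-monoˡ-≤ n b≤k+n))))

∀Fin⇒∀< : ∀ {n} {P : ℕ → Set} → (∀ (i : Fin n) → P (toℕ i)) → ∀ {N} → N < n → P N
∀Fin⇒∀< {P = P} all N<n = subst P (toℕ-fromℕ< N<n) (all (fromℕ< N<n))

D : ℕ → ℕ
D N = ⌈ N /4⌉ + 1E N

⌈8+n/4⌉ : ∀ n → ⌈ 8 + n /4⌉ ≡ ⌈ n /4⌉ + 2
⌈8+n/4⌉ n = trans (+-distrib-/-∣ˡ {8} (n + 3) {4} (divides 2 refl)) (+-comm 2 _)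

-- From 13 on, 1E computes to 0.
D-+8 : ∀ m → D (13 + m) + 2 ≡ D (21 + m)
D-+8 m = begin
  ⌈ 13 + m /4⌉ + 0 + 2  ≡⟨ cong (_+ 2) (+-identityʳ _) ⟩
  ⌈ 13 + m /4⌉ + 2      ≡⟨ sym (⌈8+n/4⌉ (13 + m)) ⟩
  ⌈ 21 + m /4⌉          ≡⟨ sym (+-identityʳ _) ⟩
  ⌈ 21 + m /4⌉ + 0      ∎
  where open ≡-Reasoning

UpperBound : ℕ → ℕ → Set
UpperBound N k = ∀ A → Admissible N A → length A ≤ k

admissible⇒length≤maxClique : ∀ {N A} → Admissible N A → length A ≤ maxClique [] (positivesUpTo N)
admissible⇒length≤maxClique ((uA , bounds) , pdf) =
  length≤maxClique [] _ uA (primeDifferenceFree⇒isClique pdf)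
    (λ a∈ → let (1≤a , a≤N) = All.lookup bounds a∈ in ∈-positivesUpTo⁺ 1≤a a≤N) (λ _ ())

upperBound-<21 : ∀ {N} → N < 21 → UpperBound N (D N)
upperBound-<21 N<21 A adm = ≤-trans (admissible⇒length≤maxClique adm) (searchBelow21 N<21)
  where
  searchBelow21 : ∀ {N} → N < 21 → maxClique [] (positivesUpTo N) ≤ D N
  searchBelow21 =
    ∀Fin⇒∀< (toWitness {a? = Fin.all? λ i → maxClique [] (positivesUpTo (toℕ i)) ≤? D (toℕ i)} _)

length-filter-∁ : ∀ {X : Set} {P : X → Set} (P? : ∀ x → Dec (P x)) xs →
                  length xs ≡ length (filter P? xs) + length (filter (∁? P?) xs)
length-filter-∁ P? []       = refl
length-filter-∁ P? (x ∷ xs) with does (P? x)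
... | true  = cong suc (length-filter-∁ P? xs)
... | false = trans (cong suc (length-filter-∁ P? xs)) (sym (+-suc _ _))

blockBound : ∀ n {B} → Unique B → PrimeDifferenceFree B →
             B ⊆ map (n +_) (positivesUpTo 8) → length B ≤ 2
blockBound n {B} uB pdf B⊆ = begin
  length B
    ≤⟨ length≤maxClique [] _ uB (primeDifferenceFree⇒isClique pdf) B⊆ (λ _ ()) ⟩
  maxClique [] (map (n +_) (positivesUpTo 8))  ≡⟨ maxClique-+ n [] (positivesUpTo 8) ⟩
  maxClique [] (positivesUpTo 8)               ≡⟨⟩
  2                                            ∎
  where open ≤-Reasoning

upperBound-+8 : ∀ {n k} → UpperBound n k → UpperBound (8 + n) (k + 2)
upperBound-+8 {n} {k} bound A ((uA , bounds) , pdf) = begin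
  length A                   ≡⟨ length-filter-∁ (_≤? n) A ⟩
  length low + length high   ≤⟨ +-mono-≤ (bound low lowAdmissible) highBound ⟩
  k + 2                      ∎
  where
  open ≤-Reasoning
  low high : List ℕ
  low  = filter (_≤? n) A
  high = filter (∁? (_≤? n)) A
  low⊆A : low ⊆ A
  low⊆A = filter-⊆ (_≤? n) A
  high⊆A : high ⊆ A
  high⊆A = filter-⊆ (∁? (_≤? n)) A
  lowAdmissible : Admissible n low
  lowAdmissible = (Unique.filter⁺ (_≤? n) uA , lowBounds) , primeDifferenceFree-⊆ low⊆A pdf
    where
    lowBounds : All (λ a → 1 ≤ a × a ≤ n) low
    lowBounds = All.tabulate λ a∈ →
      let (a∈A , a≤n) = ∈-filter⁻ (_≤? n) a∈ in proj₁ (All.lookup bounds a∈A) , a≤n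
  highBound : length high ≤ 2
  highBound = blockBound n (Unique.filter⁺ (∁? (_≤? n)) uA) (primeDifferenceFree-⊆ high⊆A pdf)
    λ a∈ → let (a∈A , a≰n) = ∈-filter⁻ (∁? (_≤? n)) a∈ in
           ∈-shiftedPositives⁺ (≰⇒> a≰n) (proj₂ (All.lookup bounds a∈A))

upperBound : ∀ N → UpperBound N (D N)
upperBound = <-rec (λ N → UpperBound N (D N)) upperBound′
  where
  upperBound′ : ∀ N → (∀ {M} → M < N → UpperBound M (D M)) → UpperBound N (D N)
  upperBound′ N rec with N <? 21
  ... | yes N<21 = upperBound-<21 N<21
  ... | no N≮21 = case m≤n⇒∃[o]m+o≡n (≮⇒≥ N≮21) of λ where
    (m , refl) → subst (UpperBound (21 + m)) (D-+8 m)
                   (upperBound-+8 (rec (m<n+m (13 + m) {8} (s≤s z≤n))))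

¬prime[n*4] : ∀ n → ¬ Prime (n * 4)
¬prime[n*4] zero      p = NonZero.nonZero (prime⇒nonZero p)
¬prime[n*4] n@(suc _) = composite⇒¬prime (composite-∣ composite[4] (divides n refl))

oneModFour : ℕ → List ℕ
oneModFour = applyUpTo (λ i → suc (i * 4))

oneModFour-admissible : ∀ N → Admissible N (oneModFour ⌈ N /4⌉)
oneModFour-admissible N = (unique , All.tabulate bounds) , pdf
  where
  q = ⌈ N /4⌉
  unique : Unique (oneModFour q)
  unique = Unique.applyUpTo⁺₁ _ q λ i<j _ eq → <⇒≢ i<j (*-cancelʳ-≡ _ _ 4 (suc-injective eq))
  bounds : ∀ {a} → a ∈ oneModFour q → 1 ≤ a × a ≤ N
  bounds a∈ with i , i<q , refl ← ∈-applyUpTo⁻ _ a∈ =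
    s≤s z≤n , +-cancelˡ-≤ 3 _ _ (subst (suc i * 4 ≤_) (+-comm N 3)
                                   (≤-trans (*-monoˡ-≤ 4 i<q) (m/n*n≤m (N + 3) 4)))
  pdf : PrimeDifferenceFree (oneModFour q)
  pdf a∈ b∈ with i , _ , refl ← ∈-applyUpTo⁻ _ a∈ | j , _ , refl ← ∈-applyUpTo⁻ _ b∈ =
    ¬prime[n*4] (i ∸ j) ∘ subst Prime (sym (*-distribʳ-∸ 4 i j))

primeDifferenceFree? : ∀ A → Dec (PrimeDifferenceFree A)
primeDifferenceFree? A =
  map′ (λ all a∈ b∈ → All.lookup (All.lookup all a∈) b∈)
       (λ pdf → All.tabulate λ a∈ → All.tabulate λ b∈ → pdf a∈ b∈)
       (all? (λ a → all? (λ b → ¬? (prime? (a ∸ b))) A) A)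

admissible? : ∀ N A → Dec (Admissible N A)
admissible? N A =
  (unique? _≟_ A ×-dec all? (λ a → (1 ≤? a) ×-dec (a ≤? N)) A) ×-dec primeDifferenceFree? A

extremal : ℕ → List ℕ
extremal 2  = 1 ∷ 2 ∷ []
extremal 3  = 1 ∷ 2 ∷ []
extremal 4  = 1 ∷ 2 ∷ []
extremal 11 = 1 ∷ 2 ∷ 10 ∷ 11 ∷ []
extremal 12 = 1 ∷ 2 ∷ 10 ∷ 11 ∷ []
extremal N  = oneModFour ⌈ N /4⌉

IsExtremal : ℕ → List ℕ → Set
IsExtremal N A = Admissible N A × length A ≡ D N

extremal-isExtremal : ∀ N → IsExtremal N (extremal N)
extremal-isExtremal N with N <? 13
... | yes N<13 = ∀Fin⇒∀< (toWitness {a? = Fin.all? λ i → isExtremal? (toℕ i)} _) N<13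
  where
  isExtremal? : ∀ N → Dec (IsExtremal N (extremal N))
  isExtremal? N = admissible? N (extremal N) ×-dec (length (extremal N) ≟ D N)
... | no N≮13 = case m≤n⇒∃[o]m+o≡n (≮⇒≥ N≮13) of λ where
  (m , refl) → oneModFour-admissible (13 + m) , trans (length-applyUpTo _ _) (sym (+-identityʳ _))

theorem1p2 : (N : ℕ) → 1 ≤ N → IsMaxAdmissibleSize N (⌈ N /4⌉ + 1E N)
theorem1p2 N _ = (extremal N , extremal-isExtremal N) , upperBound N
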